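{- Let $f:\{0,1\}^n\to\{0,1\}$ be a monotone Boolean function, and let $d=\min\{\Gamma^1(f),\Gamma^0(f)\}$. Then there is a decision tree of rank at most $d$ computing $f$, and there is a polynomial threshold function of degree at most $d$ computing $f$.
   Context: A partial assignment is $b\in\{0,1,*\}^n$; $a\succeq b$ means $a_i=b_i$ whenever $b_i\ne *$. $b$ is a $0$-certificate (resp. $1$-certificate) of $f$ if $f(a)=0$ (resp. $1$) for all $a\in\{0,1\}^n$ with $a\succeq b$. For $b_i=*$, $b_{x_i\leftarrow\ell}$ is $b$ with coordinate $i$ set to $\ell\in\{0,1\}$. $g:\{0,1,*\}^n\to\mathbb{Z}_{\ge0}$ is monotone if $g(b_{x_i\leftarrow\ell})\ge g(b)$ whenever $b_i=*$, and submodular if $g(b_{x_i\leftarrow\ell})-g(b)\ge g(b'_{x_i\leftarrow\ell})-g(b')$ whenever $b'\succeq b$, $b_i=b'_i=*$. A $1$-goal function for $f$ is a monotone submodular $g$ with a constant $Q\ge0$ (its $1$-goal value) such that $g(b)=Q$ if $b$ is a $1$-certificate of $f$ and $g(b)<Q$ otherwise; $\Gamma^1(f)$ is the minimum $1$-goal value of a $1$-goal function for $f$. $0$-goal functions and $\Gamma^0(f)$ are defined analogously with $0$-certificates. A decision tree computing $f$ is a binary tree whose internal nodes are labeled by variables $x_i$ and leaves by $0$ or $1$; at a node labeled $x_i$ one goes left if $x_i=0$ and right if $x_i=1$; it computes $f$ if for every $x\in\{0,1\}^n$ the leaf reached is labeled $f(x)$. The rank of a tree: a leaf has rank $0$; otherwise,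 with subtree ranks $r_0,r_1$ of the root's children, the rank is $\max\{r_0,r_1\}$ if $r_0\ne r_1$ and $r_0+1$ if $r_0=r_1$. A polynomial threshold function of degree $d$ computing $f$ is a real multivariate polynomial $p(x_1,\ldots,x_n)$ of total degree $d$ with $f(x)=\mathrm{sgn}(p(x))$ for all $x\in\{0,1\}^n$, where $\mathrm{sgn}(z)=1$ if $z\ge0$ and $\mathrm{sgn}(z)=0$ if $z<0$. -}

module Defs where

open import Data.Nat as ℕ using (ℕ; suc; _⊔_; _⊓_)
open import Data.Bool as B using (Bool; true; false; if_then_else_)
open import Data.Maybe using (Maybe; just; nothing)
open import Data.Fin using (Fin)
open import Data.Vec using (Vec; lookup; _[_]≔_)
open import Data.List using (List; foldr; map; all)
open import Data.Product using (Σ; _×_; ∃; ∃-syntax; _,_)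
open import Data.Rational as Q using (ℚ; 0ℚ; 1ℚ; _≤ᵇ_)
open import Relation.Binary.PropositionalEquality using (_≡_)
open import Relation.Nullary using (¬_)

-- Boolean functions on {0,1}^n (false = 0, true = 1)
BoolFun : ℕ → Set
BoolFun n = Vec Bool n → Bool

MonotoneBF : {n : ℕ} → BoolFun n → Set
MonotoneBF {n} f = ∀ (x y : Vec Bool n) → (∀ i → lookup x i B.≤ lookup y i) → f x B.≤ f y

-- partial assignments {0,1,*}^n ; nothing = *
PA : ℕ → Set
PA n = Vec (Maybe Bool) n

_≽_ : {n : ℕ} → Vec Bool n → PA n → Set
a ≽ b = ∀ i v → lookup b i ≡ just v → lookup a i ≡ v

_≽ₚ_ : {n : ℕ} → PA n → PA n → Set
b' ≽ₚ b = ∀ i v → lookup b i ≡ just v → lookup b' i ≡ just v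

Certificate : {n : ℕ} → Bool → BoolFun n → PA n → Set
Certificate {n} ℓ f b = ∀ (a : Vec Bool n) → a ≽ b → f a ≡ ℓ

setVar : {n : ℕ} → PA n → Fin n → Bool → PA n
setVar b i ℓ = b [ i ]≔ just ℓ

MonotoneG : {n : ℕ} → (PA n → ℕ) → Set
MonotoneG g = ∀ b i ℓ → lookup b i ≡ nothing → g b ℕ.≤ g (setVar b i ℓ)

-- g(b_{x_i←ℓ}) - g(b) ≥ g(b'_{x_i←ℓ}) - g(b')  (integer differences),
-- written additively over ℕ
SubmodularG : {n : ℕ} → (PA n → ℕ) → Set
SubmodularG g = ∀ b b' i ℓ → b' ≽ₚ b → lookup b i ≡ nothing → lookup b' i ≡ nothing →
  g (setVar b' i ℓ) ℕ.+ g b ℕ.≤ g (setVar b i ℓ) ℕ.+ g b'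

IsGoalFunction : {n : ℕ} → Bool → BoolFun n → (PA n → ℕ) → ℕ → Set
IsGoalFunction ℓ f g Q =
  MonotoneG g × SubmodularG g ×
  (∀ b → Certificate ℓ f b → g b ≡ Q) ×
  (∀ b → ¬ Certificate ℓ f b → g b ℕ.< Q)

IsGamma : {n : ℕ} → Bool → BoolFun n → ℕ → Set
IsGamma {n} ℓ f γ =
  (∃[ g ] IsGoalFunction ℓ f g γ) ×
  (∀ (g : PA n → ℕ) Q → IsGoalFunction ℓ f g Q → γ ℕ.≤ Q)

data DTree (n : ℕ) : Set where
  leaf : Bool → DTree n
  node : Fin n → DTree n → DTree n → DTree n

evalDT : {n : ℕ} → DTree n → Vec Bool n → Bool
evalDT (leaf v) x = v
evalDT (node i t₀ t₁) x = if lookup x i then evalDT t₁ x else evalDT t₀ x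

rank : {n : ℕ} → DTree n → ℕ
rank (leaf _) = 0
rank (node _ t₀ t₁) with rank t₀ ℕ.≟ rank t₁
... | Relation.Nullary.yes _ = suc (rank t₀)
... | Relation.Nullary.no  _ = rank t₀ ⊔ rank t₁

DTComputes : {n : ℕ} → DTree n → BoolFun n → Set
DTComputes t f = ∀ x → evalDT t x ≡ f x

-- multivariate polynomials over ℚ: a list of terms (coefficient, monomial),
-- a monomial being a list of variables (repetitions allowed)
Monomial : ℕ → Set
Monomial n = List (Fin n)

Poly : ℕ → Set
Poly n = List (ℚ × Monomial n)

bitℚ : Bool → ℚ
bitℚ true = 1ℚ
bitℚ false = 0ℚ

evalMono : {n : ℕ} → Monomial n → Vec Bool n → ℚ
evalMono m x = foldr (λ i r → bitℚ (lookup x i) Q.* r) 1ℚ m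

evalPoly : {n : ℕ} → Poly n → Vec Bool n → ℚ
evalPoly p x = foldr (λ { (c , m) r → c Q.* evalMono m x Q.+ r }) 0ℚ p

DegreeAtMost : {n : ℕ} → Poly n → ℕ → Set
DegreeAtMost p d = ∀ c m → Data.List.Membership.Propositional._∈_ (c , m) p →
  Data.List.length m ℕ.≤ d
  where import Data.List.Membership.Propositional

sgn : ℚ → Bool
sgn z = 0ℚ ≤ᵇ z

PTFComputes : {n : ℕ} → Poly n → BoolFun n → Set
PTFComputes p f = ∀ x → f x ≡ sgn (evalPoly p x)

-- Given an ℓ-goal function g with goal value Q, query greedily. A partial assignment b with
-- g b = Q is an ℓ-certificate, so the tree stops there with a leaf. Otherwise pick a free
-- variable whose ℓ-setting raises g: the ℓ-child then needs one unit less of the budget Q − g b,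
-- and the other child no more since g is monotone. If no variable raises g, submodularity shows
-- that filling all free variables with ℓ does not raise g either, so that filling is no
-- certificate, and since f is monotone no extension of b has value ℓ. Every node of the
-- resulting tree has a child of smaller budget, which bounds its rank by Q.
--
-- Such a tree is turned into a threshold polynomial bottom-up: at a node whose cheap child is
-- reached when x_j = c, take p_other + 2A·[x_j = c]·p_cheap, where A bounds |p_other|. The cheap
-- child's sign dominates wherever it is reached, and only the cheap side's degree goes up.

module Submission where

open import Defs
open import Data.Bool as Bool using (Bool; true; false; not)
import Data.Bool.Properties as Bool
open import Data.Fin as Fin using (Fin; zero; suc)
import Data.Fin.Properties as Fin
open import Data.List using ([]; _∷_; _++_; map; length)
open import Data.List.Membership.Propositional.Properties using (∈-++⁻; ∈-map⁻)
open import Data.List.Relation.Unary.Any using (here)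
open import Data.Maybe using (just; nothing; fromMaybe)
import Data.Maybe.Properties as Maybe
open import Data.Nat as ℕ using (ℕ; suc; _≤_; _<_; _⊓_; z≤n; s≤s)
import Data.Nat.Properties as ℕ
open import Data.Product using (_×_; _,_; proj₁; proj₂; ∃-syntax; map₁; map₂)
open import Data.Rational as ℚ using (ℚ; 0ℚ; 1ℚ; _*_; -_)
import Data.Rational.Properties as ℚ
open import Data.Sum using (_⊎_; inj₁; inj₂; [_,_])
import Data.Sum as Sum
open import Data.Unit using (tt)
open import Data.Vec as Vec using (Vec; []; _∷_; lookup; replicate)
import Data.Vec.Properties as Vec
open import Function using (_∘_; id)
open import Function.Bundles using (Equivalence)
open import Relation.Binary.PropositionalEquality hiding ([_])
open import Relation.Nullary using (¬_; Dec; contradiction)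
open import Relation.Nullary.Decidable using (yes; no; _×-dec_; decidable-stable; dec⇒maybe)
open import Tactic.RingSolver using (solve-∀)
open import Tactic.RingSolver.Core.AlmostCommutativeRing using (AlmostCommutativeRing; fromCommutativeRing)

variable
  n r : ℕ

stars : PA n → ℕ
stars []            = 0
stars (nothing ∷ b) = suc (stars b)
stars (just _ ∷ b)  = stars b

stars-setVar : ∀ (b : PA n) {i} v → lookup b i ≡ nothing → stars b ≡ suc (stars (setVar b i v))
stars-setVar (nothing ∷ b) {zero}  v _  = refl
stars-setVar (nothing ∷ b) {suc i} v bᵢ = cong suc (stars-setVar b v bᵢ)
stars-setVar (just _ ∷ b)  {suc i} v bᵢ = stars-setVar b v bᵢ

star-induction : (P : PA n → Set) →
  (∀ b → (∀ i v → lookup b i ≡ nothing → P (setVar b i v)) → P b) → ∀ b → P b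
star-induction P step b = go b (stars b) refl
  where
  go : ∀ b k → stars b ≡ k → P b
  go b ℕ.zero  b★ = step b λ i v bᵢ → contradiction (trans (sym (stars-setVar b v bᵢ)) b★) ℕ.1+n≢0
  go b (suc k) b★ = step b λ i v bᵢ →
    go (setVar b i v) k (ℕ.suc-injective (trans (sym (stars-setVar b v bᵢ)) b★))

fill : Bool → PA n → PA n
fill ℓ = Vec.map (just ∘ fromMaybe ℓ)

fill-setVar : ∀ ℓ (b : PA n) {i} → lookup b i ≡ nothing → fill ℓ (setVar b i ℓ) ≡ fill ℓ b
fill-setVar ℓ (nothing ∷ b) {zero}  _  = refl
fill-setVar ℓ (nothing ∷ b) {suc i} bᵢ = cong (just ℓ ∷_) (fill-setVar ℓ b bᵢ)
fill-setVar ℓ (just v ∷ b)  {suc i} bᵢ = cong (just v ∷_) (fill-setVar ℓ b bᵢ)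

star-or-filled : ∀ ℓ (b : PA n) → (∃[ i ] lookup b i ≡ nothing) ⊎ fill ℓ b ≡ b
star-or-filled ℓ []            = inj₂ refl
star-or-filled ℓ (nothing ∷ b) = inj₁ (zero , refl)
star-or-filled ℓ (just v ∷ b)  = Sum.map (λ (i , bᵢ) → suc i , bᵢ) (cong (just v ∷_)) (star-or-filled ℓ b)

≽-fill : ∀ ℓ (b : PA n) {a : Vec Bool n} → a ≽ fill ℓ b → ∀ i → lookup a i ≡ fromMaybe ℓ (lookup b i)
≽-fill ℓ b {a} a≽ i = a≽ i _ (Vec.lookup-map i (just ∘ fromMaybe ℓ) b)

setVar-≽ₚ : ∀ (b : PA n) {i} v → lookup b i ≡ nothing → setVar b i v ≽ₚ b
setVar-≽ₚ b {i} v bᵢ k w bₖ with k Fin.≟ i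
... | yes refl = contradiction (trans (sym bₖ) bᵢ) λ ()
... | no  k≢i  = trans (Vec.lookup∘update′ k≢i b (just v)) bₖ

≽-setVar : ∀ a (b : PA n) {i v} → a ≽ b → lookup a i ≡ v → a ≽ setVar b i v
≽-setVar a b {i} {v} a≽b aᵢ≡v k w bₖ with k Fin.≟ i
... | yes refl = trans aᵢ≡v (Maybe.just-injective (trans (sym (Vec.lookup∘update i b (just v))) bₖ))
... | no  k≢i  = a≽b k w (trans (sym (Vec.lookup∘update′ k≢i b (just v))) bₖ)

≽ₚ-star : ∀ (b c : PA n) {i} → c ≽ₚ b → lookup c i ≡ nothing → lookup b i ≡ nothing
≽ₚ-star b c {i} c≽b cᵢ with lookup b i in bᵢ
... | nothing = refl
... | just v  = contradiction (trans (sym (c≽b i v bᵢ)) cᵢ) λ ()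

≽-empty : ∀ (a : Vec Bool n) → a ≽ replicate n nothing
≽-empty a i v e = contradiction (trans (sym (Vec.lookup-replicate i nothing)) e) λ ()

≤-true : ∀ {x y} → x Bool.≤ y → x ≡ true → y ≡ true
≤-true Bool.b≤b x≡1 = x≡1
≤-true Bool.f≤t _   = refl

true⇒≤ : ∀ x y → (x ≡ true → y ≡ true) → x Bool.≤ y
true⇒≤ false y     _ = Bool.≤-minimum y
true⇒≤ true  y x⇒y = Bool.≤-reflexive (sym (x⇒y refl))

≤-false : ∀ {x y} → x Bool.≤ y → y ≡ false → x ≡ false
≤-false Bool.b≤b y≡0 = y≡0

false⇒≥ : ∀ x y → (x ≡ false → y ≡ false) → y Bool.≤ x
false⇒≥ true  y _   = Bool.≤-maximum y
false⇒≥ false y x⇒y = Bool.≤-reflexive (x⇒y refl)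

monotone-preserves : ∀ {f : BoolFun n} → MonotoneBF f → ∀ ℓ {a a′} →
  (∀ i → lookup a i ≡ ℓ → lookup a′ i ≡ ℓ) → f a ≡ ℓ → f a′ ≡ ℓ
monotone-preserves mono true  a⇒a′ = ≤-true (mono _ _ λ i → true⇒≤ _ _ (a⇒a′ i))
monotone-preserves mono false a⇒a′ = ≤-false (mono _ _ λ i → false⇒≥ _ _ (a⇒a′ i))

fill-certificate : ∀ {f : BoolFun n} → MonotoneBF f → ∀ {ℓ} b a → a ≽ b → f a ≡ ℓ → Certificate ℓ f (fill ℓ b)
fill-certificate mono {ℓ} b a a≽b fa≡ℓ a′ a′≽fill = monotone-preserves mono ℓ agree fa≡ℓ
  where
  agree : ∀ i → lookup a i ≡ ℓ → lookup a′ i ≡ ℓ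
  agree i aᵢ≡ℓ with lookup b i in bᵢ | ≽-fill ℓ b {a′} a′≽fill i
  ... | nothing | a′ᵢ≡ℓ = a′ᵢ≡ℓ
  ... | just v  | a′ᵢ≡v = trans a′ᵢ≡v (trans (sym (a≽b i v bᵢ)) aᵢ≡ℓ)

-- Trees of bounded rank from goal functions

branch : Fin n → Bool → DTree n → DTree n → DTree n
branch j false s t = node j s t
branch j true  s t = node j t s

evalDT-branch-on : ∀ {j c} {s t : DTree n} {x} → lookup x j ≡ c → evalDT (branch j c s t) x ≡ evalDT s x
evalDT-branch-on {c = false} xⱼ≡c rewrite xⱼ≡c = refl
evalDT-branch-on {c = true}  xⱼ≡c rewrite xⱼ≡c = refl

evalDT-branch-off : ∀ {j c} {s t : DTree n} {x} → lookup x j ≡ not c → evalDT (branch j c s t) x ≡ evalDT t x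
evalDT-branch-off {c = false} xⱼ≡¬c rewrite xⱼ≡¬c = refl
evalDT-branch-off {c = true}  xⱼ≡¬c rewrite xⱼ≡¬c = refl

data RankAtMost {n} : ℕ → DTree n → Set where
  leaf : ∀ {r v} → RankAtMost r (leaf v)
  node : ∀ {r} c j {s t : DTree n} → RankAtMost r s → RankAtMost (suc r) t → RankAtMost (suc r) (branch j c s t)

rank-node≤ : ∀ j (t₀ t₁ : DTree n) {r} → rank t₀ ≤ suc r → rank t₁ ≤ suc r →
  rank t₀ ≤ r ⊎ rank t₁ ≤ r → rank (node j t₀ t₁) ≤ suc r
rank-node≤ j t₀ t₁ r₀≤ r₁≤ one≤ with rank t₀ ℕ.≟ rank t₁
... | yes r₀≡r₁ = s≤s ([ id , (λ r₁≤r → subst (_≤ _) (sym r₀≡r₁) r₁≤r) ] one≤)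
... | no  _     = ℕ.⊔-lub r₀≤ r₁≤

RankAtMost⇒rank≤ : ∀ {t : DTree n} → RankAtMost r t → rank t ≤ r
RankAtMost⇒rank≤ leaf = z≤n
RankAtMost⇒rank≤ (node true  j {s} {t} cheap other) =
  rank-node≤ j t s (RankAtMost⇒rank≤ other) (ℕ.m≤n⇒m≤1+n (RankAtMost⇒rank≤ cheap)) (inj₂ (RankAtMost⇒rank≤ cheap))
RankAtMost⇒rank≤ (node false j {s} {t} cheap other) =
  rank-node≤ j s t (ℕ.m≤n⇒m≤1+n (RankAtMost⇒rank≤ cheap)) (RankAtMost⇒rank≤ other) (inj₁ (RankAtMost⇒rank≤ cheap))

TreeOfRank : ℕ → BoolFun n → Set
TreeOfRank r f = ∃[ t ] RankAtMost r t × DTComputes t f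

TreeOfRank-⊓ : ∀ {f : BoolFun n} a b → TreeOfRank a f → TreeOfRank b f → TreeOfRank (a ⊓ b) f
TreeOfRank-⊓ a b tree-a tree-b with ℕ.⊓-sel a b
... | inj₁ a⊓b≡a rewrite a⊓b≡a = tree-a
... | inj₂ a⊓b≡b rewrite a⊓b≡b = tree-b

module GoalTree {f : BoolFun n} (mono : MonotoneBF f) {ℓ g Q} (goal : IsGoalFunction ℓ f g Q) where

  open import Data.Nat using (_+_)

  g-monotone : MonotoneG g
  g-monotone = proj₁ goal

  g-submodular : SubmodularG g
  g-submodular = proj₁ (proj₂ goal)

  g-certificate : ∀ b → Certificate ℓ f b → g b ≡ Q
  g-certificate = proj₁ (proj₂ (proj₂ goal))

  g-below : ∀ b → ¬ Certificate ℓ f b → g b < Q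
  g-below = proj₂ (proj₂ (proj₂ goal))

  goal⇒certificate : ∀ b → Q ≤ g b → Certificate ℓ f b
  goal⇒certificate b Q≤gb a a≽b =
    decidable-stable (f a Bool.≟ ℓ) λ fa≢ℓ → ℕ.<⇒≱ (g-below b λ cert → fa≢ℓ (cert a a≽b)) Q≤gb

  NoGain : PA n → Set
  NoGain b = ∀ i → lookup b i ≡ nothing → g (setVar b i ℓ) ≤ g b

  NoGain-≽ₚ : ∀ b c → NoGain b → c ≽ₚ b → NoGain c
  NoGain-≽ₚ b c noGain c≽b i cᵢ = ℕ.+-cancelʳ-≤ (g b) (g (setVar c i ℓ)) (g c) (begin
    g (setVar c i ℓ) + g b ≤⟨ g-submodular b c i ℓ c≽b bᵢ cᵢ ⟩
    g (setVar b i ℓ) + g c ≤⟨ ℕ.+-monoˡ-≤ (g c) (noGain i bᵢ) ⟩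
    g b + g c              ≡⟨ ℕ.+-comm (g b) (g c) ⟩
    g c + g b              ∎)
    where
    open ℕ.≤-Reasoning
    bᵢ = ≽ₚ-star b c c≽b cᵢ

  NoGain⇒fill≤ : ∀ b → NoGain b → g (fill ℓ b) ≤ g b
  NoGain⇒fill≤ = star-induction (λ b → NoGain b → g (fill ℓ b) ≤ g b) step
    where
    step : ∀ b → (∀ i v → lookup b i ≡ nothing → NoGain (setVar b i v) → g (fill ℓ (setVar b i v)) ≤ g (setVar b i v)) →
           NoGain b → g (fill ℓ b) ≤ g b
    step b ih noGain with star-or-filled ℓ b
    ... | inj₂ filled   = ℕ.≤-reflexive (cong g filled)
    ... | inj₁ (i , bᵢ) = begin
      g (fill ℓ b)              ≡⟨ cong g (fill-setVar ℓ b bᵢ) ⟨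
      g (fill ℓ (setVar b i ℓ)) ≤⟨ ih i ℓ bᵢ (NoGain-≽ₚ b (setVar b i ℓ) noGain (setVar-≽ₚ b ℓ bᵢ)) ⟩
      g (setVar b i ℓ)          ≤⟨ noGain i bᵢ ⟩
      g b                       ∎
      where open ℕ.≤-Reasoning

  NoGain⇒opposite : ∀ b → g b < Q → NoGain b → ∀ a → a ≽ b → f a ≡ not ℓ
  NoGain⇒opposite b gb<Q noGain a a≽b = Bool.¬-not λ fa≡ℓ → ℕ.<⇒≱ gb<Q (begin
    Q            ≡⟨ g-certificate (fill ℓ b) (fill-certificate mono b a a≽b fa≡ℓ) ⟨
    g (fill ℓ b) ≤⟨ NoGain⇒fill≤ b noGain ⟩
    g b          ∎)
    where open ℕ.≤-Reasoning

  Subtree : PA n → Set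
  Subtree b = ∀ r → Q ≤ r + g b → ∃[ t ] RankAtMost r t × (∀ a → a ≽ b → evalDT t a ≡ f a)

  gain⇒Subtree : ∀ b i → lookup b i ≡ nothing → g b < g (setVar b i ℓ) → g b < Q →
    Subtree (setVar b i ℓ) → Subtree (setVar b i (not ℓ)) → Subtree b
  gain⇒Subtree b i bᵢ gain gb<Q _ _ ℕ.zero Q≤gb = contradiction Q≤gb (ℕ.<⇒≱ gb<Q)
  gain⇒Subtree b i bᵢ gain gb<Q subtree-ℓ subtree-¬ℓ (suc r) Q≤1+r+gb
    with subtree-ℓ r fits-ℓ | subtree-¬ℓ (suc r) fits-¬ℓ
    where
    fits-ℓ : Q ≤ r + g (setVar b i ℓ)
    fits-ℓ = ℕ.≤-trans Q≤1+r+gb (ℕ.≤-trans (ℕ.≤-reflexive (sym (ℕ.+-suc r (g b)))) (ℕ.+-monoʳ-≤ r gain))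
    fits-¬ℓ : Q ≤ suc r + g (setVar b i (not ℓ))
    fits-¬ℓ = ℕ.≤-trans Q≤1+r+gb (ℕ.+-monoʳ-≤ (suc r) (g-monotone b i (not ℓ) bᵢ))
  ... | s , s-rank , s-agrees | t , t-rank , t-agrees = branch i ℓ s t , node ℓ i s-rank t-rank , agrees
    where
    agrees : ∀ a → a ≽ b → evalDT (branch i ℓ s t) a ≡ f a
    agrees a a≽b with lookup a i Bool.≟ ℓ
    ... | yes aᵢ≡ℓ = trans (evalDT-branch-on aᵢ≡ℓ) (s-agrees a (≽-setVar a b a≽b aᵢ≡ℓ))
    ... | no  aᵢ≢ℓ = trans (evalDT-branch-off aᵢ≡¬ℓ) (t-agrees a (≽-setVar a b a≽b aᵢ≡¬ℓ))
      where aᵢ≡¬ℓ = Bool.¬-not aᵢ≢ℓ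

  subtree : ∀ b → Subtree b
  subtree = star-induction Subtree step
    where
    gain? : ∀ b i → Dec (lookup b i ≡ nothing × g b < g (setVar b i ℓ))
    gain? b i = Maybe.≡-dec Bool._≟_ (lookup b i) nothing ×-dec suc (g b) ℕ.≤? g (setVar b i ℓ)

    step : ∀ b → (∀ i v → lookup b i ≡ nothing → Subtree (setVar b i v)) → Subtree b
    step b child r Q≤r+gb with Q ℕ.≤? g b
    ... | yes Q≤gb = leaf ℓ , leaf , λ a a≽b → sym (goal⇒certificate b Q≤gb a a≽b)
    ... | no  Q≰gb with Fin.any? (gain? b)
    ...   | yes (i , bᵢ , gain) =
            gain⇒Subtree b i bᵢ gain (ℕ.≰⇒> Q≰gb) (child i ℓ bᵢ) (child i (not ℓ) bᵢ) r Q≤r+gb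
    ...   | no  noGain =
            leaf (not ℓ) , leaf , λ a a≽b → sym (NoGain⇒opposite b (ℕ.≰⇒> Q≰gb) noGain′ a a≽b)
      where
      noGain′ : NoGain b
      noGain′ i bᵢ = ℕ.≮⇒≥ λ gain → noGain (i , bᵢ , gain)

  goal-tree : TreeOfRank Q f
  goal-tree with subtree (replicate n nothing) Q (ℕ.m≤m+n Q _)
  ... | t , rank≤ , agrees = t , rank≤ , λ x → agrees x (≽-empty x)

-- Threshold polynomials from trees of bounded rank

open import Data.Rational using (_+_)

ℚ-ring : AlmostCommutativeRing _ _
ℚ-ring = fromCommutativeRing ℚ.+-*-commutativeRing (λ x → dec⇒maybe (0ℚ ℚ.≟ x))

scale : ℚ → Poly n → Poly n
scale k = map (map₁ (k *_))

timesVar : Fin n → Poly n → Poly n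
timesVar j = map (map₂ (j ∷_))

guard : Fin n → Bool → Poly n → Poly n
guard j true  p = timesVar j p
guard j false p = p ++ timesVar j (scale (- 1ℚ) p)

evalPoly-++ : ∀ (p q : Poly n) x → evalPoly (p ++ q) x ≡ evalPoly p x + evalPoly q x
evalPoly-++ []            q x = sym (ℚ.+-identityˡ _)
evalPoly-++ ((c , m) ∷ p) q x = begin
  c * evalMono m x + evalPoly (p ++ q) x                ≡⟨ cong (c * evalMono m x +_) (evalPoly-++ p q x) ⟩
  c * evalMono m x + (evalPoly p x + evalPoly q x)      ≡⟨ ℚ.+-assoc (c * evalMono m x) (evalPoly p x) (evalPoly q x) ⟨
  c * evalMono m x + evalPoly p x + evalPoly q x        ∎
  where open ≡-Reasoning

evalPoly-map : ∀ (h : ℚ × Monomial n → ℚ × Monomial n) s x →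
  (∀ c m → proj₁ (h (c , m)) * evalMono (proj₂ (h (c , m))) x ≡ s * (c * evalMono m x)) →
  ∀ p → evalPoly (map h p) x ≡ s * evalPoly p x
evalPoly-map h s x h-scales []            = sym (ℚ.*-zeroʳ s)
evalPoly-map h s x h-scales ((c , m) ∷ p) = begin
  proj₁ (h (c , m)) * evalMono (proj₂ (h (c , m))) x + evalPoly (map h p) x
    ≡⟨ cong₂ _+_ (h-scales c m) (evalPoly-map h s x h-scales p) ⟩
  s * (c * evalMono m x) + s * evalPoly p x
    ≡⟨ ℚ.*-distribˡ-+ s (c * evalMono m x) (evalPoly p x) ⟨
  s * (c * evalMono m x + evalPoly p x) ∎
  where open ≡-Reasoning

evalPoly-scale : ∀ k (p : Poly n) x → evalPoly (scale k p) x ≡ k * evalPoly p x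
evalPoly-scale k p x = evalPoly-map _ k x (λ c m → ℚ.*-assoc k c (evalMono m x)) p

evalPoly-timesVar : ∀ j (p : Poly n) x → evalPoly (timesVar j p) x ≡ bitℚ (lookup x j) * evalPoly p x
evalPoly-timesVar j p x = evalPoly-map _ (bitℚ (lookup x j)) x (λ c m → commute c (bitℚ (lookup x j)) (evalMono m x)) p
  where
  commute : ∀ c b e → c * (b * e) ≡ b * (c * e)
  commute = solve-∀ ℚ-ring

evalPoly-timesVar-on : ∀ j (p : Poly n) x → lookup x j ≡ true → evalPoly (timesVar j p) x ≡ evalPoly p x
evalPoly-timesVar-on j p x xⱼ≡1 = begin
  evalPoly (timesVar j p) x          ≡⟨ evalPoly-timesVar j p x ⟩
  bitℚ (lookup x j) * evalPoly p x   ≡⟨ cong (λ b → bitℚ b * evalPoly p x) xⱼ≡1 ⟩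
  1ℚ * evalPoly p x                  ≡⟨ ℚ.*-identityˡ (evalPoly p x) ⟩
  evalPoly p x                       ∎
  where open ≡-Reasoning

evalPoly-timesVar-off : ∀ j (p : Poly n) x → lookup x j ≡ false → evalPoly (timesVar j p) x ≡ 0ℚ
evalPoly-timesVar-off j p x xⱼ≡0 = begin
  evalPoly (timesVar j p) x          ≡⟨ evalPoly-timesVar j p x ⟩
  bitℚ (lookup x j) * evalPoly p x   ≡⟨ cong (λ b → bitℚ b * evalPoly p x) xⱼ≡0 ⟩
  0ℚ * evalPoly p x                  ≡⟨ ℚ.*-zeroˡ (evalPoly p x) ⟩
  0ℚ                                 ∎
  where open ≡-Reasoning

evalPoly-guard-on : ∀ j c (p : Poly n) x → lookup x j ≡ c → evalPoly (guard j c p) x ≡ evalPoly p x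
evalPoly-guard-on j true  p x xⱼ≡c = evalPoly-timesVar-on j p x xⱼ≡c
evalPoly-guard-on j false p x xⱼ≡c = begin
  evalPoly (p ++ timesVar j (scale (- 1ℚ) p)) x                 ≡⟨ evalPoly-++ p (timesVar j (scale (- 1ℚ) p)) x ⟩
  evalPoly p x + evalPoly (timesVar j (scale (- 1ℚ) p)) x       ≡⟨ cong (evalPoly p x +_) (evalPoly-timesVar-off j (scale (- 1ℚ) p) x xⱼ≡c) ⟩
  evalPoly p x + 0ℚ                                             ≡⟨ ℚ.+-identityʳ (evalPoly p x) ⟩
  evalPoly p x                                                  ∎
  where open ≡-Reasoning

evalPoly-guard-off : ∀ j c (p : Poly n) x → lookup x j ≡ not c → evalPoly (guard j c p) x ≡ 0ℚ
evalPoly-guard-off j true  p x xⱼ≡¬c = evalPoly-timesVar-off j p x xⱼ≡¬c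
evalPoly-guard-off j false p x xⱼ≡¬c = begin
  evalPoly (p ++ timesVar j (scale (- 1ℚ) p)) x                 ≡⟨ evalPoly-++ p (timesVar j (scale (- 1ℚ) p)) x ⟩
  evalPoly p x + evalPoly (timesVar j (scale (- 1ℚ) p)) x       ≡⟨ cong (evalPoly p x +_) (evalPoly-timesVar-on j (scale (- 1ℚ) p) x xⱼ≡¬c) ⟩
  evalPoly p x + evalPoly (scale (- 1ℚ) p) x                    ≡⟨ cong (evalPoly p x +_) (evalPoly-scale (- 1ℚ) p x) ⟩
  evalPoly p x + - 1ℚ * evalPoly p x                            ≡⟨ cancel (evalPoly p x) ⟩
  0ℚ                                                            ∎
  where
  open ≡-Reasoning
  cancel : ∀ v → v + - 1ℚ * v ≡ 0ℚ
  cancel = solve-∀ ℚ-ring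

degree-weaken : ∀ {p : Poly n} {d d′} → d ≤ d′ → DegreeAtMost p d → DegreeAtMost p d′
degree-weaken d≤d′ deg c m m∈p = ℕ.≤-trans (deg c m m∈p) d≤d′

degree-++ : ∀ {p q : Poly n} {d} → DegreeAtMost p d → DegreeAtMost q d → DegreeAtMost (p ++ q) d
degree-++ {p = p} degp degq c m m∈p++q with ∈-++⁻ p m∈p++q
... | inj₁ m∈p = degp c m m∈p
... | inj₂ m∈q = degq c m m∈q

degree-map : ∀ {p : Poly n} {d} k (h : ℚ × Monomial n → ℚ × Monomial n) →
  (∀ c m → length (proj₂ (h (c , m))) ≤ k ℕ.+ length m) →
  DegreeAtMost p d → DegreeAtMost (map h p) (k ℕ.+ d)
degree-map k h h-raises deg c m m∈hp with ∈-map⁻ h m∈hp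
... | (c′ , m′) , m′∈p , refl = ℕ.≤-trans (h-raises c′ m′) (ℕ.+-monoʳ-≤ k (deg c′ m′ m′∈p))

degree-scale : ∀ k {p : Poly n} {d} → DegreeAtMost p d → DegreeAtMost (scale k p) d
degree-scale k = degree-map 0 _ (λ _ _ → ℕ.≤-refl)

degree-timesVar : ∀ j {p : Poly n} {d} → DegreeAtMost p d → DegreeAtMost (timesVar j p) (suc d)
degree-timesVar j = degree-map 1 _ (λ _ _ → ℕ.≤-refl)

degree-guard : ∀ j c {p : Poly n} {d} → DegreeAtMost p d → DegreeAtMost (guard j c p) (suc d)
degree-guard j true  deg = degree-timesVar j deg
degree-guard j false deg = degree-++ (degree-weaken (ℕ.n≤1+n _) deg) (degree-timesVar j (degree-scale (- 1ℚ) deg))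

InBand : ℚ → Bool → ℚ → Set
InBand M true  v = 1ℚ ℚ.≤ v × v ℚ.≤ M
InBand M false v = - M ℚ.≤ v × v ℚ.≤ - 1ℚ

0≤1 : 0ℚ ℚ.≤ 1ℚ
0≤1 = ℚ.≤ᵇ⇒≤ tt

-1≤1 : - 1ℚ ℚ.≤ 1ℚ
-1≤1 = ℚ.≤ᵇ⇒≤ tt

*-monoˡ-≤-1≤ : ∀ {k} → 1ℚ ℚ.≤ k → ∀ {u v} → u ℚ.≤ v → k * u ℚ.≤ k * v
*-monoˡ-≤-1≤ {k} 1≤k = ℚ.*-monoˡ-≤-nonNeg k {{ℚ.nonNegative (ℚ.≤-trans 0≤1 1≤k)}}

band-bounded : ∀ {M} e {v} → 1ℚ ℚ.≤ M → InBand M e v → - M ℚ.≤ v × v ℚ.≤ M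
band-bounded true  1≤M (1≤v , v≤M)   = ℚ.≤-trans (ℚ.≤-trans (ℚ.neg-antimono-≤ 1≤M) -1≤1) 1≤v , v≤M
band-bounded false 1≤M (-M≤v , v≤-1) = -M≤v , ℚ.≤-trans v≤-1 (ℚ.≤-trans -1≤1 1≤M)

band-weaken : ∀ {M M′} e {v} → M ℚ.≤ M′ → InBand M e v → InBand M′ e v
band-weaken true  M≤M′ (1≤v , v≤M)   = 1≤v , ℚ.≤-trans v≤M M≤M′
band-weaken false M≤M′ (-M≤v , v≤-1) = ℚ.≤-trans (ℚ.neg-antimono-≤ M≤M′) -M≤v , v≤-1

1≤p⇒1≤p+p : ∀ {a} → 1ℚ ℚ.≤ a → 1ℚ ℚ.≤ a + a
1≤p⇒1≤p+p {a} 1≤a = begin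
  1ℚ      ≡⟨ ℚ.+-identityʳ 1ℚ ⟨
  1ℚ + 0ℚ ≤⟨ ℚ.+-mono-≤ 1≤a (ℚ.≤-trans 0≤1 1≤a) ⟩
  a + a   ∎
  where open ℚ.≤-Reasoning

p≤p+[p+p]*q : ∀ {a b} → 1ℚ ℚ.≤ a → 1ℚ ℚ.≤ b → a ℚ.≤ a + (a + a) * b
p≤p+[p+p]*q {a} {b} 1≤a 1≤b = begin
  a                ≡⟨ ℚ.+-identityʳ a ⟨
  a + 0ℚ           ≡⟨ cong (a +_) (ℚ.*-zeroʳ (a + a)) ⟨
  a + (a + a) * 0ℚ ≤⟨ ℚ.+-monoʳ-≤ a (*-monoˡ-≤-1≤ (1≤p⇒1≤p+p 1≤a) (ℚ.≤-trans 0≤1 1≤b)) ⟩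
  a + (a + a) * b  ∎
  where open ℚ.≤-Reasoning

band-dominate : ∀ {a b u w} e → 1ℚ ℚ.≤ a → - a ℚ.≤ u → u ℚ.≤ a →
  InBand b e w → InBand (a + (a + a) * b) e (u + (a + a) * w)
band-dominate {a} {b} {u} {w} true 1≤a -a≤u u≤a (1≤w , w≤b) = lower , upper
  where
  open ℚ.≤-Reasoning
  lower = begin
    1ℚ                    ≤⟨ 1≤a ⟩
    a                     ≡⟨ identity a ⟩
    - a + (a + a) * 1ℚ    ≤⟨ ℚ.+-mono-≤ -a≤u (*-monoˡ-≤-1≤ (1≤p⇒1≤p+p 1≤a) 1≤w) ⟩
    u + (a + a) * w       ∎
    where
    identity : ∀ a → a ≡ - a + (a + a) * 1ℚ
    identity = solve-∀ ℚ-ring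
  upper = ℚ.+-mono-≤ u≤a (*-monoˡ-≤-1≤ (1≤p⇒1≤p+p 1≤a) w≤b)
band-dominate {a} {b} {u} {w} false 1≤a -a≤u u≤a (-b≤w , w≤-1) = lower , upper
  where
  open ℚ.≤-Reasoning
  lower = begin
    - (a + (a + a) * b)   ≡⟨ identity a b ⟩
    - a + (a + a) * - b   ≤⟨ ℚ.+-mono-≤ -a≤u (*-monoˡ-≤-1≤ (1≤p⇒1≤p+p 1≤a) -b≤w) ⟩
    u + (a + a) * w       ∎
    where
    identity : ∀ a b → - (a + (a + a) * b) ≡ - a + (a + a) * - b
    identity = solve-∀ ℚ-ring
  upper = begin
    u + (a + a) * w       ≤⟨ ℚ.+-mono-≤ u≤a (*-monoˡ-≤-1≤ (1≤p⇒1≤p+p 1≤a) w≤-1) ⟩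
    a + (a + a) * - 1ℚ    ≡⟨ identity a ⟩
    - a                   ≤⟨ ℚ.neg-antimono-≤ 1≤a ⟩
    - 1ℚ                  ∎
    where
    identity : ∀ a → a + (a + a) * - 1ℚ ≡ - a
    identity = solve-∀ ℚ-ring

band-sgn : ∀ {M} e {v} → InBand M e v → sgn v ≡ e
band-sgn true  (1≤v , _)  = Equivalence.to Bool.T-≡ (ℚ.≤⇒≤ᵇ (ℚ.≤-trans 0≤1 1≤v))
band-sgn false (_ , v≤-1) = Bool.¬-not λ 0≤v → ℚ.≤⇒≤ᵇ (ℚ.≤-trans {0ℚ} (ℚ.≤ᵇ⇒≤ (Equivalence.from Bool.T-≡ 0≤v)) v≤-1)

record BandedPTF (r : ℕ) (t : DTree n) : Set where
  field
    poly    : Poly n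
    bound   : ℚ
    1≤bound : 1ℚ ℚ.≤ bound
    degree  : DegreeAtMost poly r
    inBand  : ∀ x → InBand bound (evalDT t x) (evalPoly poly x)

signℚ : Bool → ℚ
signℚ true  = 1ℚ
signℚ false = - 1ℚ

leaf-ptf : ∀ v → BandedPTF {n} r (leaf v)
leaf-ptf v = record
  { poly    = (signℚ v , []) ∷ []
  ; bound   = 1ℚ
  ; 1≤bound = ℚ.≤-refl
  ; degree  = λ { _ _ (here refl) → z≤n }
  ; inBand  = λ _ → band v
  }
  where
  band : ∀ v → InBand 1ℚ v (signℚ v * 1ℚ + 0ℚ)
  band true  = ℚ.≤-refl , ℚ.≤-refl
  band false = ℚ.≤-refl , ℚ.≤-refl

node-ptf : ∀ c j {s t : DTree n} → BandedPTF r s → BandedPTF (suc r) t → BandedPTF (suc r) (branch j c s t)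
node-ptf c j {s} {t} cheap other = record
  { poly    = poly other ++ guard j c (scale (A + A) (poly cheap))
  ; bound   = A + (A + A) * B
  ; 1≤bound = ℚ.≤-trans (1≤bound other) (p≤p+[p+p]*q (1≤bound other) (1≤bound cheap))
  ; degree  = degree-++ (degree other) (degree-guard j c (degree-scale (A + A) (degree cheap)))
  ; inBand  = band
  }
  where
  open BandedPTF
  A = bound other
  B = bound cheap
  band : ∀ x → InBand (A + (A + A) * B) (evalDT (branch j c s t) x)
                 (evalPoly (poly other ++ guard j c (scale (A + A) (poly cheap))) x)
  u = λ x → evalPoly (poly other) x
  band x with lookup x j Bool.≟ c | band-bounded (evalDT t x) (1≤bound other) (inBand other x)
  ... | yes xⱼ≡c | -A≤u , u≤A = subst₂ (InBand (A + (A + A) * B)) (sym tree≡) (sym poly≡)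
        (band-dominate (evalDT s x) (1≤bound other) -A≤u u≤A (inBand cheap x))
    where
    tree≡ = evalDT-branch-on xⱼ≡c
    poly≡ = trans (evalPoly-++ (poly other) _ x) (cong (u x +_)
              (trans (evalPoly-guard-on j c _ x xⱼ≡c) (evalPoly-scale (A + A) (poly cheap) x)))
  ... | no xⱼ≢c | _ = subst₂ (InBand (A + (A + A) * B)) (sym tree≡) (sym poly≡)
        (band-weaken (evalDT t x) (p≤p+[p+p]*q (1≤bound other) (1≤bound cheap)) (inBand other x))
    where
    xⱼ≡¬c = Bool.¬-not xⱼ≢c
    tree≡ = evalDT-branch-off xⱼ≡¬c
    poly≡ = trans (evalPoly-++ (poly other) _ x)
              (trans (cong (u x +_) (evalPoly-guard-off j c _ x xⱼ≡¬c)) (ℚ.+-identityʳ (u x)))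

RankAtMost⇒BandedPTF : ∀ {t : DTree n} → RankAtMost r t → BandedPTF r t
RankAtMost⇒BandedPTF (leaf {v = v})            = leaf-ptf v
RankAtMost⇒BandedPTF (node c j cheap other) =
  node-ptf c j (RankAtMost⇒BandedPTF cheap) (RankAtMost⇒BandedPTF other)

RankAtMost⇒PTF : ∀ {t : DTree n} → RankAtMost r t → ∃[ p ] PTFComputes p (evalDT t) × DegreeAtMost p r
RankAtMost⇒PTF rank≤ = poly , (λ x → sym (band-sgn _ (inBand x))) , degree
  where open BandedPTF (RankAtMost⇒BandedPTF rank≤)

theorem7 : (n : ℕ) (f : BoolFun n) → MonotoneBF f →
    (γ₁ γ₀ : ℕ) → IsGamma true f γ₁ → IsGamma false f γ₀ →
    (∃[ t ] (DTComputes t f × rank t ≤ γ₁ ⊓ γ₀)) ×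
    (∃[ p ] (PTFComputes p f × DegreeAtMost p (γ₁ ⊓ γ₀)))
theorem7 n f mono γ₁ γ₀ ((g₁ , goal₁) , _) ((g₀ , goal₀) , _)
  with TreeOfRank-⊓ γ₁ γ₀ (GoalTree.goal-tree mono goal₁) (GoalTree.goal-tree mono goal₀)
... | t , rank≤ , computes with RankAtMost⇒PTF rank≤
...   | p , thresholds , degree =
  (t , computes , RankAtMost⇒rank≤ rank≤) , (p , (λ x → trans (sym (computes x)) (thresholds x)) , degree)
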